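{- (Necessitation) Let $m\in\{4,5\}$. For every $\varphi\in Fm(C)$: if $\vdash_m\varphi$, then $\vdash_m\square\varphi$.
   Context: Let $V=\{x_0,x_1,x_2,\dots\}$ be a countable, linearly ordered set of propositional variables and $C$ a set of propositional constants with $\top,\bot\in C$. $Fm(C)$ is the set of formulas generated from $V\cup C$ by the unary connectives $\neg,\square$, the binary connectives $\rightarrow,\vee,\wedge,\equiv$ (propositional identity), and the propositional quantifier $\forall$, where $\forall x\varphi$ is a formula only if $x\in V$ occurs free in $\varphi$; $fvar(\varphi)$ is the set of free variables. A substitution $\sigma\colon V\cup C\to Fm(C)$ extends homomorphically over connectives, and $(\forall x\varphi)[\sigma]=\forall y(\varphi[\sigma[x:=y]])$, where $y$ is the least variable greater than all variables free in some $\sigma(u)$ with $u$ a free variable or constant of $\forall x\varphi$. $\varphi[x:=\psi]$ substitutes $\psi$ for $x$. $\varphi=_\alpha\psi$ means $\varphi,\psi$ differ at most in bound variables. The axiom set $\mathbb{AX}$ is the smallest set containing all formulas of the following forms and closed under: if $\varphi\in\mathbb{AX}$ and $x\in fvar(\varphi)$ then $\forall x\varphi\in\mathbb{AX}$: (i) substitution instances of classical propositional tautologies; (ii) $\square\varphi\rightarrow\varphi$; (iii) $\square(\varphi\rightarrow\psi)\rightarrow(\square\varphi\rightarrow\square\psi)$; (iv) $\square(\varphi\rightarrow\psi)\rightarrow\square(\square\varphi\rightarrow\square\psi)$; (v) $\varphi\equiv\psi$ whenever $\varphi=_\alpha\psi$; (vi) $(\varphi\equiv\psi)\rightarrow(\varphi\rightarrow\psi)$;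 (vii) $(\psi\equiv\psi')\rightarrow(\varphi[x:=\psi]\equiv\varphi[x:=\psi'])$ if $x\in fvar(\varphi)$; (viii) $\forall x(\varphi\equiv\psi)\rightarrow(\forall x\varphi\equiv\forall x\psi)$; (ix) $\forall x\varphi\rightarrow\varphi[x:=\psi]$; (x) $\forall x(\varphi\rightarrow\psi)\rightarrow(\forall x\varphi\rightarrow\forall x\psi)$; (xi) $\forall x(\varphi\rightarrow\psi)\rightarrow(\varphi\rightarrow\forall x\psi)$ if $x\notin fvar(\varphi)$; (xii) $\square\forall x\varphi\rightarrow\forall x\square\varphi$; (xiii) $\forall x\square\varphi\rightarrow\square\forall x\varphi$. Rules: Modus Ponens, and Axiom Necessitation (from an axiom $\varphi$ infer $\square\varphi$); derivations are finite sequences of premises, axioms, and results of these rules. $\vdash_4$ denotes derivability in the system with the scheme $\square\varphi\rightarrow\square\square\varphi$ added to the axioms ($S4^\forall_\equiv$), and $\vdash_5$ in the system with additionally $\neg\square\varphi\rightarrow\square\neg\square\varphi$ ($S5^\forall_\equiv$). -}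

module Defs where

open import Data.Nat using (ℕ; zero; suc; _⊔_; _≟_)
open import Data.Bool using (Bool; true; false; not; _∧_; _∨_; if_then_else_)
open import Data.List using (List; []; _∷_; _++_; filter; concatMap; foldr)
open import Data.List.Membership.Propositional using (_∈_; _∉_)
open import Data.Product using (_×_; _,_; Σ; ∃)
open import Data.Sum using (_⊎_)
open import Relation.Nullary using (¬?; does)
open import Relation.Binary.PropositionalEquality using (_≡_; _≢_)

data Const (C : Set) : Set where
  ctop : Const C
  cbot : Const C
  cother : C → Const C

-- Raw formulas; the variable x_i is represented by i (so the linear order
-- on V is the order on ℕ).
infixr 5 _⇒_
infixr 6 _⋁_
infixr 7 _⋀_
infix 8 _≐_
data Fm (C : Set) : Set where
  var : ℕ → Fm C
  con : Const C → Fm C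
  neg : Fm C → Fm C
  box : Fm C → Fm C
  _⇒_ : Fm C → Fm C → Fm C
  _⋁_ : Fm C → Fm C → Fm C
  _⋀_ : Fm C → Fm C → Fm C
  _≐_ : Fm C → Fm C → Fm C
  all : ℕ → Fm C → Fm C

module _ {C : Set} where

  fv : Fm C → List ℕ
  fv (var x) = x ∷ []
  fv (con k) = []
  fv (neg φ) = fv φ
  fv (box φ) = fv φ
  fv (φ ⇒ ψ) = fv φ ++ fv ψ
  fv (φ ⋁ ψ) = fv φ ++ fv ψ
  fv (φ ⋀ ψ) = fv φ ++ fv ψ
  fv (φ ≐ ψ) = fv φ ++ fv ψ
  fv (all x φ) = filter (λ z → ¬? (z ≟ x)) (fv φ)

  consts : Fm C → List (Const C)
  consts (var x) = []
  consts (con k) = k ∷ []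
  consts (neg φ) = consts φ
  consts (box φ) = consts φ
  consts (φ ⇒ ψ) = consts φ ++ consts ψ
  consts (φ ⋁ ψ) = consts φ ++ consts ψ
  consts (φ ⋀ ψ) = consts φ ++ consts ψ
  consts (φ ≐ ψ) = consts φ ++ consts ψ
  consts (all x φ) = consts φ

  -- well-formedness: ∀ x φ is a formula only if x occurs free in φ.
  -- Fm(C) of the paper = raw formulas satisfying WF.
  WF : Fm C → Set
  WF (var x) = Data.Unit.⊤ where import Data.Unit
  WF (con k) = Data.Unit.⊤ where import Data.Unit
  WF (neg φ) = WF φ
  WF (box φ) = WF φ
  WF (φ ⇒ ψ) = WF φ × WF ψ
  WF (φ ⋁ ψ) = WF φ × WF ψ
  WF (φ ⋀ ψ) = WF φ × WF ψ
  WF (φ ≐ ψ) = WF φ × WF ψ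
  WF (all x φ) = (x ∈ fv φ) × WF φ

  record Sub : Set where
    constructor mkSub
    field
      onVar : ℕ → Fm C
      onConst : Const C → Fm C
  open Sub public

  _[_↦_] : Sub → ℕ → Fm C → Sub
  σ [ x ↦ ψ ] = mkSub (λ z → if does (z ≟ x) then ψ else onVar σ z) (onConst σ)

  fresh : List ℕ → ℕ
  fresh = foldr (λ a r → suc a ⊔ r) 0

  _⟦_⟧ : Fm C → Sub → Fm C
  var x ⟦ σ ⟧ = onVar σ x
  con k ⟦ σ ⟧ = onConst σ k
  neg φ ⟦ σ ⟧ = neg (φ ⟦ σ ⟧)
  box φ ⟦ σ ⟧ = box (φ ⟦ σ ⟧)
  (φ ⇒ ψ) ⟦ σ ⟧ = (φ ⟦ σ ⟧) ⇒ (ψ ⟦ σ ⟧)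
  (φ ⋁ ψ) ⟦ σ ⟧ = (φ ⟦ σ ⟧) ⋁ (ψ ⟦ σ ⟧)
  (φ ⋀ ψ) ⟦ σ ⟧ = (φ ⟦ σ ⟧) ⋀ (ψ ⟦ σ ⟧)
  (φ ≐ ψ) ⟦ σ ⟧ = (φ ⟦ σ ⟧) ≐ (ψ ⟦ σ ⟧)
  all x φ ⟦ σ ⟧ = all y (φ ⟦ σ [ x ↦ var y ] ⟧)
    where
    y : ℕ
    y = fresh (concatMap (λ u → fv (onVar σ u)) (fv (all x φ))
               ++ concatMap (λ k → fv (onConst σ k)) (consts (all x φ)))

  idSub : Sub
  idSub = mkSub var con

  _[_≔_] : Fm C → ℕ → Fm C → Fm C
  φ [ x ≔ ψ ] = φ ⟦ idSub [ x ↦ ψ ] ⟧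

  AlphaVar : List (ℕ × ℕ) → ℕ → ℕ → Set
  AlphaVar [] x y = x ≡ y
  AlphaVar ((a , b) ∷ Γ) x y = (x ≡ a × y ≡ b) ⊎ (x ≢ a × y ≢ b × AlphaVar Γ x y)

  data Alpha (Γ : List (ℕ × ℕ)) : Fm C → Fm C → Set where
    α-var : ∀ {x y} → AlphaVar Γ x y → Alpha Γ (var x) (var y)
    α-con : ∀ {k} → Alpha Γ (con k) (con k)
    α-neg : ∀ {φ φ'} → Alpha Γ φ φ' → Alpha Γ (neg φ) (neg φ')
    α-box : ∀ {φ φ'} → Alpha Γ φ φ' → Alpha Γ (box φ) (box φ')
    α-imp : ∀ {φ φ' ψ ψ'} → Alpha Γ φ φ' → Alpha Γ ψ ψ' → Alpha Γ (φ ⇒ ψ) (φ' ⇒ ψ')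
    α-or  : ∀ {φ φ' ψ ψ'} → Alpha Γ φ φ' → Alpha Γ ψ ψ' → Alpha Γ (φ ⋁ ψ) (φ' ⋁ ψ')
    α-and : ∀ {φ φ' ψ ψ'} → Alpha Γ φ φ' → Alpha Γ ψ ψ' → Alpha Γ (φ ⋀ ψ) (φ' ⋀ ψ')
    α-id  : ∀ {φ φ' ψ ψ'} → Alpha Γ φ φ' → Alpha Γ ψ ψ' → Alpha Γ (φ ≐ ψ) (φ' ≐ ψ')
    α-all : ∀ {x y φ ψ} → Alpha ((x , y) ∷ Γ) φ ψ → Alpha Γ (all x φ) (all y ψ)

  _=α_ : Fm C → Fm C → Set
  φ =α ψ = Alpha [] φ ψ

data PF : Set where
  atom : ℕ → PF
  pneg : PF → PF
  pimp : PF → PF → PF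
  por  : PF → PF → PF
  pand : PF → PF → PF

eval : (ℕ → Bool) → PF → Bool
eval v (atom i) = v i
eval v (pneg τ) = not (eval v τ)
eval v (pimp τ ρ) = not (eval v τ) ∨ eval v ρ
eval v (por τ ρ) = eval v τ ∨ eval v ρ
eval v (pand τ ρ) = eval v τ ∧ eval v ρ

Tautology : PF → Set
Tautology τ = ∀ (v : ℕ → Bool) → eval v τ ≡ true

inst : {C : Set} → (ℕ → Fm C) → PF → Fm C
inst s (atom i) = s i
inst s (pneg τ) = neg (inst s τ)
inst s (pimp τ ρ) = inst s τ ⇒ inst s ρ
inst s (por τ ρ) = inst s τ ⋁ inst s ρ
inst s (pand τ ρ) = inst s τ ⋀ inst s ρ

data Sys : Set where
  S4 S5 : Sys

data Scheme {C : Set} : Sys → Fm C → Set where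
  ax-taut : ∀ {m} (τ : PF) (s : ℕ → Fm C) → Tautology τ → Scheme m (inst s τ)
  ax-T    : ∀ {m} φ → Scheme m (box φ ⇒ φ)
  ax-K    : ∀ {m} φ ψ → Scheme m (box (φ ⇒ ψ) ⇒ (box φ ⇒ box ψ))
  ax-iv   : ∀ {m} φ ψ → Scheme m (box (φ ⇒ ψ) ⇒ box (box φ ⇒ box ψ))
  ax-α    : ∀ {m} φ ψ → φ =α ψ → Scheme m (φ ≐ ψ)
  ax-vi   : ∀ {m} φ ψ → Scheme m ((φ ≐ ψ) ⇒ (φ ⇒ ψ))
  ax-vii  : ∀ {m} φ ψ ψ' x → x ∈ fv φ →
            Scheme m ((ψ ≐ ψ') ⇒ (φ [ x ≔ ψ ] ≐ φ [ x ≔ ψ' ]))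
  ax-viii : ∀ {m} x φ ψ → Scheme m (all x (φ ≐ ψ) ⇒ (all x φ ≐ all x ψ))
  ax-ix   : ∀ {m} x φ ψ → Scheme m (all x φ ⇒ φ [ x ≔ ψ ])
  ax-x    : ∀ {m} x φ ψ → Scheme m (all x (φ ⇒ ψ) ⇒ (all x φ ⇒ all x ψ))
  ax-xi   : ∀ {m} x φ ψ → x ∉ fv φ → Scheme m (all x (φ ⇒ ψ) ⇒ (φ ⇒ all x ψ))
  ax-xii  : ∀ {m} x φ → Scheme m (box (all x φ) ⇒ all x (box φ))
  ax-xiii : ∀ {m} x φ → Scheme m (all x (box φ) ⇒ box (all x φ))
  ax-4    : ∀ {m} φ → Scheme m (box φ ⇒ box (box φ))
  ax-5    : ∀ φ → Scheme S5 (neg (box φ) ⇒ box (neg (box φ)))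

data AX {C : Set} (m : Sys) : Fm C → Set where
  base : ∀ {χ} → WF χ → Scheme m χ → AX m χ
  gen  : ∀ {φ x} → AX m φ → x ∈ fv φ → AX m (all x φ)

infix 3 _⊢_
data _⊢_ {C : Set} (m : Sys) : Fm C → Set where
  axiom : ∀ {φ} → AX m φ → m ⊢ φ
  mp    : ∀ {φ ψ} → m ⊢ (φ ⇒ ψ) → m ⊢ φ → m ⊢ ψ
  nec   : ∀ {φ} → AX m φ → m ⊢ box φ

-- Induction on derivations: a necessitated axiom is boxed again by axiom 4,
-- and a modus ponens step is boxed by distributing □ over it with axiom K.
-- Well-formedness of the instances of K and 4 used along the way comes from
-- the fact that every derivable formula is well-formed.
module Submission where

open import Data.Product using (_,_; proj₂)

open import Defs

module _ {C : Set} {m : Sys} where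

  AX⇒WF : {φ : Fm C} → AX m φ → WF φ
  AX⇒WF (base wf _)  = wf
  AX⇒WF (gen ax x∈φ) = x∈φ , AX⇒WF ax

  ⊢⇒WF : {φ : Fm C} → m ⊢ φ → WF φ
  ⊢⇒WF (axiom ax)  = AX⇒WF ax
  ⊢⇒WF (mp ⊢φ⇒ψ _) = proj₂ (⊢⇒WF ⊢φ⇒ψ)
  ⊢⇒WF (nec ax)    = AX⇒WF ax

  ⊢-box-mp : {φ ψ : Fm C} → m ⊢ box (φ ⇒ ψ) → m ⊢ box φ → m ⊢ box ψ
  ⊢-box-mp {φ} {ψ} ⊢□φ⇒ψ ⊢□φ =
    mp (mp (axiom (base (wf□φ⇒ψ , wf□φ , wf□ψ) (ax-K φ ψ))) ⊢□φ⇒ψ) ⊢□φ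
    where
    wf□φ⇒ψ : WF (box (φ ⇒ ψ))
    wf□φ⇒ψ = ⊢⇒WF ⊢□φ⇒ψ
    wf□φ : WF (box φ)
    wf□φ = ⊢⇒WF ⊢□φ
    wf□ψ : WF (box ψ)
    wf□ψ = proj₂ wf□φ⇒ψ

  ⊢-box-box : {φ : Fm C} → AX m φ → m ⊢ box (box φ)
  ⊢-box-box {φ} ax = mp (axiom (base (wf , wf) (ax-4 φ))) (nec ax)
    where
    wf : WF φ
    wf = AX⇒WF ax

  ⊢-necessitation : {φ : Fm C} → m ⊢ φ → m ⊢ box φ
  ⊢-necessitation (axiom ax)   = nec ax
  ⊢-necessitation (mp ⊢φ⇒ψ ⊢φ) = ⊢-box-mp (⊢-necessitation ⊢φ⇒ψ) (⊢-necessitation ⊢φ)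
  ⊢-necessitation (nec ax)     = ⊢-box-box ax

-- The hypothesis WF φ is redundant: it already follows from m ⊢ φ by ⊢⇒WF.
lemma5 : {C : Set} (m : Sys) (φ : Fm C) → WF φ → m ⊢ φ → m ⊢ box φ
lemma5 m φ _ ⊢φ = ⊢-necessitation ⊢φ
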